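{- Let $w\in S_n$ contain the pattern $132$, let $p=\max\{t : \exists\, i<t<j,\ w_i<w_j<w_t\}$ and $q=\max\{j : j>p,\ w_j<w_p,\ \exists\, i<p,\ w_i<w_j\}$, and let $w'=wt_{p,q}t_{i,p}$ for some $i\in I(wt_{p,q},p)$. Suppose $w'$ also contains the pattern $132$, and let $p',q'$ be the indices defined for $w'$ by the same formulas. Then $(p',w'_{q'})<(p,w_q)$ in the total order on boxes given by $(a,b)<(c,d)$ iff $a<c$, or $a=c$ and $b<d$.
   Context: Permutations are in one-line notation; $\ell(u)$ is the number of inversions; $ut_{a,b}$ is obtained from $u$ by swapping the entries in positions $a$ and $b$; $I(u,k)=\{i<k:\ell(ut_{i,k})=\ell(u)+1\}$. -}

module Defs where

open import Data.Nat using (ℕ; suc)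
open import Data.Fin using (Fin; _<_; _<?_; _≤_)
open import Data.Fin.Permutation using (Permutation′; _⟨$⟩ʳ_; _∘ₚ_; transpose)
open import Data.List using (List; length; filter; cartesianProduct; allFin)
open import Data.Product using (_×_; _,_; ∃; ∃-syntax; proj₁; proj₂)
open import Data.Sum using (_⊎_)
open import Relation.Binary.PropositionalEquality using (_≡_)
open import Relation.Nullary.Decidable using (_×-dec_)

-- Positions and values are 0-indexed elements of Fin n (order-isomorphic
-- to 1..n, so all order conditions are unchanged).

_!_ : ∀ {n} → Permutation′ n → Fin n → Fin n
u ! i = u ⟨$⟩ʳ i

-- u t_{a,b} : swap entries in positions a and b, i.e. (u t_{a,b})(i) = u(t_{a,b}(i))
_·t[_,_] : ∀ {n} → Permutation′ n → Fin n → Fin n → Permutation′ n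
u ·t[ a , b ] = transpose a b ∘ₚ u

ℓ : ∀ {n} → Permutation′ n → ℕ
ℓ {n} u = length (filter (λ ij → (proj₁ ij <? proj₂ ij) ×-dec ((u ! proj₂ ij) <? (u ! proj₁ ij)))
                         (cartesianProduct (allFin n) (allFin n)))

_∈I[_,_] : ∀ {n} → Fin n → Permutation′ n → Fin n → Set
i ∈I[ u , k ] = (i < k) × (ℓ (u ·t[ i , k ]) ≡ suc (ℓ u))

Mid132 : ∀ {n} → Permutation′ n → Fin n → Set
Mid132 w t = ∃[ i ] ∃[ j ] ((i < t) × (t < j) × ((w ! i) < (w ! j)) × ((w ! j) < (w ! t)))

Contains132 : ∀ {n} → Permutation′ n → Set
Contains132 w = ∃[ t ] Mid132 w t

IsMax : ∀ {n} → (Fin n → Set) → Fin n → Set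
IsMax P m = P m × (∀ x → P x → x ≤ m)

IsP : ∀ {n} → Permutation′ n → Fin n → Set
IsP w p = IsMax (Mid132 w) p

QSet : ∀ {n} → Permutation′ n → Fin n → Fin n → Set
QSet w p j = (p < j) × ((w ! j) < (w ! p)) × (∃[ i ] ((i < p) × ((w ! i) < (w ! j))))

IsQ : ∀ {n} → Permutation′ n → Fin n → Fin n → Set
IsQ w p q = IsMax (QSet w p) q

_<box_ : ∀ {n} → Fin n × Fin n → Fin n × Fin n → Set
(a , b) <box (c , d) = (a < c) ⊎ ((a ≡ c) × (b < d))

-- If i ∈ I(w t_{p,q}, p) then w_i < w_q: a transposition t_{i,p} with i < p can only raise
-- the inversion number of u when u_i < u_p.  Hence w′ = w t_{p,q} t_{i,p} agrees with w away
-- from the positions i < p < q, where it takes the values w_q, w_i, w_p.  A 132-occurrence of w′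
-- whose middle lies beyond p would then yield one of w with middle beyond p, or an element of
-- the set defining q beyond q; so p′ ≤ p, and if p′ = p then w′_{q′} < w′_p = w_i < w_q.
module Submission where

open import Defs
open import Data.Nat as ℕ using (ℕ; zero; suc; _+_; z≤n; s≤s)
import Data.Nat.Properties as ℕP
open import Data.Nat.ListAction using () renaming (sum to sumₗ)
open import Data.Nat.ListAction.Properties using () renaming (sum-++ to sumₗ-++)
open import Data.Bool using (true; false; if_then_else_)
open import Data.Empty using (⊥-elim)
open import Data.Fin as F using (Fin; zero; suc; _<?_; _≟_)
import Data.Fin.Properties as FP
open import Data.Fin.Permutation using (Permutation′; _⟨$⟩ˡ_; transpose; inverseˡ)
import Data.Fin.Permutation.Components as PC
open import Data.List using (List; []; _∷_; _++_; length; filter; cartesianProduct; allFin; tabulate; map)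
import Data.List.Properties as LP
open import Data.Product using (_×_; _,_; proj₁; proj₂; ∃-syntax)
open import Data.Sum using (inj₁; inj₂)
open import Relation.Binary.PropositionalEquality
open import Relation.Binary.Definitions using (tri<; tri≈; tri>)
open import Relation.Nullary using (Dec; yes; no; does; ¬_)
open import Relation.Nullary.Decidable using (_×-dec_; dec-true; dec-false)
open import Relation.Unary using (Pred; Decidable)
open import Algebra.Properties.CommutativeMonoid.Sum ℕP.+-0-commutativeMonoid
  using (sum; sum-cong-≗; sum-permute)
open import Algebra.Properties.CommutativeSemigroup ℕP.+-commutativeSemigroup using (interchange)

indicator : ∀ {p} {P : Set p} → Dec P → ℕ
indicator P? = if does P? then 1 else 0

length-filter≡sum-indicator : ∀ {A : Set} {p} {P : Pred A p} (P? : Decidable P) (xs : List A) →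
  length (filter P? xs) ≡ sumₗ (map (λ x → indicator (P? x)) xs)
length-filter≡sum-indicator P? [] = refl
length-filter≡sum-indicator P? (x ∷ xs) with does (P? x)
... | true  = cong suc (length-filter≡sum-indicator P? xs)
... | false = length-filter≡sum-indicator P? xs

sum-map-tabulate : ∀ {A : Set} {n} (h : A → ℕ) (f : Fin n → A) →
  sumₗ (map h (tabulate f)) ≡ sum (λ k → h (f k))
sum-map-tabulate {n = zero}  h f = refl
sum-map-tabulate {n = suc n} h f = cong (h (f zero) +_) (sum-map-tabulate h (λ k → f (suc k)))

sum-map-cartesianProduct : ∀ {A B : Set} (g : A × B → ℕ) (xs : List A) (ys : List B) →
  sumₗ (map g (cartesianProduct xs ys)) ≡ sumₗ (map (λ x → sumₗ (map (λ y → g (x , y)) ys)) xs)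
sum-map-cartesianProduct g [] ys = refl
sum-map-cartesianProduct g (x ∷ xs) ys = begin
    sumₗ (map g (map (x ,_) ys ++ cartesianProduct xs ys))
  ≡⟨ cong sumₗ (LP.map-++ g (map (x ,_) ys) _) ⟩
    sumₗ (map g (map (x ,_) ys) ++ map g (cartesianProduct xs ys))
  ≡⟨ sumₗ-++ (map g (map (x ,_) ys)) _ ⟩
    sumₗ (map g (map (x ,_) ys)) + sumₗ (map g (cartesianProduct xs ys))
  ≡⟨ cong₂ _+_ (cong sumₗ (sym (LP.map-∘ ys))) (sum-map-cartesianProduct g xs ys) ⟩
    sumₗ (map (λ y → g (x , y)) ys) + sumₗ (map (λ x → sumₗ (map (λ y → g (x , y)) ys)) xs)
  ∎
  where open ≡-Reasoning

sum-+ : ∀ {m} (h k : Fin m → ℕ) → sum (λ x → h x + k x) ≡ sum h + sum k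
sum-+ {zero}  h k = refl
sum-+ {suc m} h k rewrite sum-+ (λ x → h (suc x)) (λ x → k (suc x)) =
  interchange (h zero) (k zero) (sum (λ x → h (suc x))) (sum (λ x → k (suc x)))

sum-mono-≤ : ∀ {m} {h k : Fin m → ℕ} → (∀ x → h x ℕ.≤ k x) → sum h ℕ.≤ sum k
sum-mono-≤ {zero}  h≤k = z≤n
sum-mono-≤ {suc m} h≤k = ℕP.+-mono-≤ (h≤k zero) (sum-mono-≤ (λ x → h≤k (suc x)))

sum-mono-< : ∀ {m} {h k : Fin m → ℕ} → (∀ x → h x ℕ.≤ k x) → (j : Fin m) → h j ℕ.< k j →
  sum h ℕ.< sum k
sum-mono-< {suc m} h≤k zero    hj<kj = ℕP.+-mono-<-≤ hj<kj (sum-mono-≤ (λ x → h≤k (suc x)))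
sum-mono-< {suc m} h≤k (suc j) hj<kj =
  ℕP.+-mono-≤-< (h≤k zero) (sum-mono-< (λ x → h≤k (suc x)) j hj<kj)

double-cancel-< : ∀ {m n} → m + m ℕ.< n + n → m ℕ.< n
double-cancel-< m+m<n+n = ℕP.≰⇒> (λ n≤m → ℕP.<⇒≱ m+m<n+n (ℕP.+-mono-≤ n≤m n≤m))

indicator-rearrangement : ∀ {X Y P Q : Set} (x : Dec X) (y : Dec Y) (P? : Dec P) (Q? : Dec Q) →
  (X → ¬ Y → P → Q) → (Y → ¬ X → Q → P) →
  indicator (x ×-dec P?) + indicator (y ×-dec Q?) ℕ.≤ indicator (x ×-dec Q?) + indicator (y ×-dec P?)
indicator-rearrangement (yes _) (yes _) (yes _) (yes _) _ _ = ℕP.≤-refl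
indicator-rearrangement (yes _) (yes _) (yes _) (no _)  _ _ = ℕP.≤-refl
indicator-rearrangement (yes _) (yes _) (no _)  (yes _) _ _ = ℕP.≤-refl
indicator-rearrangement (yes _) (yes _) (no _)  (no _)  _ _ = ℕP.≤-refl
indicator-rearrangement (yes x) (no ¬y) (yes p) Q?      x⇒ _ with Q?
... | yes _ = ℕP.≤-refl
... | no ¬q = ⊥-elim (¬q (x⇒ x ¬y p))
indicator-rearrangement (yes _) (no _)  (no _)  _       _ _ = z≤n
indicator-rearrangement (no ¬x) (yes y) P?      (yes q) _ y⇒ with P?
... | yes _ = ℕP.≤-refl
... | no ¬p = ⊥-elim (¬p (y⇒ y ¬x q))
indicator-rearrangement (no _)  (yes _) _       (no _)  _ _ = z≤n
indicator-rearrangement (no _)  (no _)  _       _       _ _ = ℕP.≤-refl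

indicator-rearrangement-strict : ∀ {X Y P Q : Set} (x : Dec X) (y : Dec Y) (P? : Dec P) (Q? : Dec Q) →
  X → ¬ Y → ¬ P → Q →
  indicator (x ×-dec P?) + indicator (y ×-dec Q?) ℕ.< indicator (x ×-dec Q?) + indicator (y ×-dec P?)
indicator-rearrangement-strict (yes _) (no _)  (no _)  (yes _) _  _  _  _ = s≤s z≤n
indicator-rearrangement-strict (no ¬x) _       _       _       x  _  _  _ = ⊥-elim (¬x x)
indicator-rearrangement-strict (yes _) (yes y) _       _       _  ¬y _  _ = ⊥-elim (¬y y)
indicator-rearrangement-strict (yes _) (no _)  (yes p) _       _  _  ¬p _ = ⊥-elim (¬p p)
indicator-rearrangement-strict (yes _) (no _)  (no _)  (no ¬q) _  _  _  q = ⊥-elim (¬q q)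

isInversion : ∀ {n} → (Fin n → Fin n) → Fin n → Fin n → ℕ
isInversion f a b = indicator ((a <? b) ×-dec (f b <? f a))

inversions : ∀ {n} → (Fin n → Fin n) → ℕ
inversions f = sum (λ a → sum (λ b → isInversion f a b))

inversions-cong : ∀ {n} {f g : Fin n → Fin n} → (∀ k → f k ≡ g k) → inversions f ≡ inversions g
inversions-cong f≗g = sum-cong-≗ (λ a → sum-cong-≗ (λ b →
  cong₂ (λ x y → indicator ((a <? b) ×-dec (y <? x))) (f≗g a) (f≗g b)))

ℓ≡inversions : ∀ {n} (u : Permutation′ n) → ℓ u ≡ inversions (u !_)
ℓ≡inversions {n} u = begin
    ℓ u
  ≡⟨ length-filter≡sum-indicator inversion? (cartesianProduct (allFin n) (allFin n)) ⟩
    sumₗ (map (λ ab → indicator (inversion? ab)) (cartesianProduct (allFin n) (allFin n)))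
  ≡⟨ sum-map-cartesianProduct (λ ab → indicator (inversion? ab)) (allFin n) (allFin n) ⟩
    sumₗ (map (λ a → sumₗ (map (isInversion (u !_) a) (allFin n))) (allFin n))
  ≡⟨ sum-map-tabulate (λ a → sumₗ (map (isInversion (u !_) a) (allFin n))) (λ k → k) ⟩
    sum (λ a → sumₗ (map (isInversion (u !_) a) (allFin n)))
  ≡⟨ sum-cong-≗ (λ a → sum-map-tabulate (isInversion (u !_) a) (λ k → k)) ⟩
    inversions (u !_)
  ∎
  where
  open ≡-Reasoning
  inversion? : (ab : Fin n × Fin n) → Dec ((proj₁ ab F.< proj₂ ab) × ((u ! proj₂ ab) F.< (u ! proj₁ ab)))
  inversion? (a , b) = (a <? b) ×-dec ((u ! b) <? (u ! a))

!-injective : ∀ {n} (u : Permutation′ n) {x y} → u ! x ≡ u ! y → x ≡ y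
!-injective u {x} {y} ux≡uy = trans (sym (inverseˡ u)) (trans (cong (u ⟨$⟩ˡ_) ux≡uy) (inverseˡ u))

module _ {n} (a b : Fin n) where
  transpose-left : PC.transpose a b a ≡ b
  transpose-left rewrite dec-true (a ≟ a) refl = refl

  transpose-right : PC.transpose a b b ≡ a
  transpose-right with b ≟ a
  ... | yes b≡a = b≡a
  ... | no _ rewrite dec-true (b ≟ b) refl = refl

  transpose-other : ∀ {k} → k ≢ a → k ≢ b → PC.transpose a b k ≡ k
  transpose-other {k} k≢a k≢b rewrite dec-false (k ≟ a) k≢a | dec-false (k ≟ b) k≢b = refl

  transpose-involutive : ∀ k → PC.transpose a b (PC.transpose a b k) ≡ k
  transpose-involutive k = by-cases k (k ≟ a) (k ≟ b)
    where
    by-cases : ∀ k → Dec (k ≡ a) → Dec (k ≡ b) → PC.transpose a b (PC.transpose a b k) ≡ k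
    by-cases _ (yes refl) _ = trans (cong (PC.transpose a b) transpose-left) transpose-right
    by-cases _ (no _) (yes refl) = trans (cong (PC.transpose a b) transpose-right) transpose-left
    by-cases _ (no k≢a) (no k≢b) =
      trans (cong (PC.transpose a b) (transpose-other k≢a k≢b)) (transpose-other k≢a k≢b)

-- Symmetrising over the pairs (a, b) and (τ a, τ b) compares the inversions of f and f ∘ τ
-- pair by pair.
module TransposeAscent {n} {i p : Fin n} (i<p : i F.< p) (f : Fin n → Fin n) (fi<fp : f i F.< f p) where
  τ : Fin n → Fin n
  τ = PC.transpose i p

  τ-involutive : ∀ k → τ (τ k) ≡ k
  τ-involutive = transpose-involutive i p

  f∘τ : Fin n → Fin n
  f∘τ k = f (τ k)

  -- τ reverses a < b only for (i, p), (i, k) and (k, p) with i < k < p.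
  flipped-inversion-stays : ∀ {a b} → a F.< b → τ b F.< τ a → f b F.< f a → f (τ b) F.< f (τ a)
  flipped-inversion-stays {a} {b} = by-cases a b (a ≟ i) (a ≟ p) (b ≟ i) (b ≟ p)
    where
    by-cases : ∀ a b → Dec (a ≡ i) → Dec (a ≡ p) → Dec (b ≡ i) → Dec (b ≡ p) →
      a F.< b → τ b F.< τ a → f b F.< f a → f (τ b) F.< f (τ a)
    by-cases _ _ (yes refl) _ _ (yes refl) _ _ _ =
      subst₂ (λ x y → f x F.< f y) (sym (transpose-right i p)) (sym (transpose-left i p)) fi<fp
    by-cases _ _ (yes refl) _ (yes refl) _ a<b _ _ = ⊥-elim (FP.<-irrefl refl a<b)
    by-cases _ _ (yes refl) _ (no b≢i) (no b≢p) _ _ fb<fa =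
      subst₂ (λ x y → f x F.< f y) (sym (transpose-other i p b≢i b≢p)) (sym (transpose-left i p))
        (FP.<-trans fb<fa fi<fp)
    by-cases _ _ (no _) (yes refl) (yes refl) _ a<b _ _ = ⊥-elim (FP.<-asym a<b i<p)
    by-cases _ _ (no _) (yes refl) (no b≢i) _ a<b τb<τa _ =
      ⊥-elim (FP.<-asym i<p (FP.<-trans a<b (subst₂ F._<_
        (transpose-other i p b≢i (λ b≡p → FP.<⇒≢ a<b (sym b≡p))) (transpose-right i p) τb<τa)))
    by-cases _ _ (no a≢i) (no a≢p) (yes refl) _ a<b τb<τa _ =
      ⊥-elim (FP.<-asym i<p (FP.<-trans
        (subst₂ F._<_ (transpose-left i p) (transpose-other i p a≢i a≢p) τb<τa) a<b))
    by-cases _ _ (no a≢i) (no a≢p) (no _) (yes refl) _ _ fb<fa =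
      subst₂ (λ x y → f x F.< f y) (sym (transpose-right i p)) (sym (transpose-other i p a≢i a≢p))
        (FP.<-trans fi<fp fb<fa)
    by-cases _ _ (no a≢i) (no a≢p) (no b≢i) (no b≢p) a<b τb<τa _ =
      ⊥-elim (FP.<-asym a<b
        (subst₂ F._<_ (transpose-other i p b≢i b≢p) (transpose-other i p a≢i a≢p) τb<τa))

  unflipped-inversion-stays : ∀ a b → a F.< b → ¬ (τ a F.< τ b) → f b F.< f a → f (τ b) F.< f (τ a)
  unflipped-inversion-stays a b a<b τa≮τb fb<fa with FP.<-cmp (τ a) (τ b)
  ... | tri< τa<τb _ _ = ⊥-elim (τa≮τb τa<τb)
  ... | tri≈ _ τa≡τb _ = ⊥-elim (FP.<⇒≢ a<b (!-injective (transpose i p) τa≡τb))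
  ... | tri> _ _ τb<τa = flipped-inversion-stays a<b τb<τa fb<fa

  pair-inversions-≤ : ∀ a b →
    isInversion f a b + isInversion f (τ a) (τ b) ℕ.≤ isInversion f∘τ a b + isInversion f∘τ (τ a) (τ b)
  pair-inversions-≤ a b rewrite τ-involutive a | τ-involutive b =
    indicator-rearrangement (a <? b) (τ a <? τ b) (f b <? f a) (f (τ b) <? f (τ a))
      (unflipped-inversion-stays a b)
      (λ τa<τb a≮b fτb<fτa → subst₂ (λ x y → f x F.< f y) (τ-involutive b) (τ-involutive a)
        (unflipped-inversion-stays (τ a) (τ b) τa<τb
          (subst₂ (λ x y → ¬ (x F.< y)) (sym (τ-involutive a)) (sym (τ-involutive b)) a≮b) fτb<fτa))

  pair-inversions-< :
    isInversion f i p + isInversion f (τ i) (τ p) ℕ.< isInversion f∘τ i p + isInversion f∘τ (τ i) (τ p)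
  pair-inversions-< rewrite τ-involutive i | τ-involutive p =
    indicator-rearrangement-strict (i <? p) (τ i <? τ p) (f p <? f i) (f (τ p) <? f (τ i))
      i<p
      (λ τi<τp → FP.<-asym i<p (subst₂ F._<_ (transpose-left i p) (transpose-right i p) τi<τp))
      (FP.<-asym fi<fp)
      (subst₂ (λ x y → f x F.< f y) (sym (transpose-right i p)) (sym (transpose-left i p)) fi<fp)

  doubled-inversions : (g : Fin n → Fin n) →
    inversions g + inversions g ≡ sum (λ a → sum (λ b → isInversion g a b + isInversion g (τ a) (τ b)))
  doubled-inversions g = begin
      inversions g + inversions g
    ≡⟨ cong (inversions g +_) (trans (sum-cong-≗ (λ a → sum-permute (isInversion g a) (transpose i p)))
                                     (sum-permute _ (transpose i p))) ⟩
      inversions g + sum (λ a → sum (λ b → isInversion g (τ a) (τ b)))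
    ≡⟨ sym (sum-+ (λ a → sum (isInversion g a)) _) ⟩
      sum (λ a → sum (isInversion g a) + sum (λ b → isInversion g (τ a) (τ b)))
    ≡⟨ sum-cong-≗ (λ a → sym (sum-+ (isInversion g a) _)) ⟩
      sum (λ a → sum (λ b → isInversion g a b + isInversion g (τ a) (τ b)))
    ∎
    where open ≡-Reasoning

  inversions-< : inversions f ℕ.< inversions f∘τ
  inversions-< = double-cancel-<
    (subst₂ ℕ._<_ (sym (doubled-inversions f)) (sym (doubled-inversions f∘τ))
      (sum-mono-< (λ a → sum-mono-≤ (pair-inversions-≤ a)) i
        (sum-mono-< (pair-inversions-≤ i) p pair-inversions-<)))

∈I⇒ascent : ∀ {n} (u : Permutation′ n) {i k : Fin n} → i ∈I[ u , k ] → (u ! i) F.< (u ! k)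
∈I⇒ascent u {i} {k} (i<k , ℓ-suc) with FP.<-cmp (u ! i) (u ! k)
... | tri< ui<uk _ _ = ui<uk
... | tri≈ _ ui≡uk _ = ⊥-elim (FP.<⇒≢ i<k (!-injective u ui≡uk))
... | tri> _ _ uk<ui = ⊥-elim (ℕP.<-asym longer shorter)
  where
  ut : Fin _ → Fin _
  ut = (u ·t[ i , k ]) !_
  open TransposeAscent i<k ut
    (subst₂ F._<_ (cong (u !_) (sym (transpose-left i k))) (cong (u !_) (sym (transpose-right i k))) uk<ui)
  shorter : ℓ (u ·t[ i , k ]) ℕ.< ℓ u
  shorter = subst₂ ℕ._<_ (sym (ℓ≡inversions (u ·t[ i , k ])))
    (trans (inversions-cong (λ j → cong (u !_) (τ-involutive j))) (sym (ℓ≡inversions u))) inversions-<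
  longer : ℓ u ℕ.< ℓ (u ·t[ i , k ])
  longer = subst (ℓ u ℕ.<_) (sym ℓ-suc) (ℕP.n<1+n (ℓ u))

<box-intro : ∀ {n} {a b c d : Fin n} → a F.≤ c → (a ≡ c → b F.< d) → (a , b) <box (c , d)
<box-intro {a = a} {c = c} a≤c a≡c⇒b<d with a ≟ c
... | yes a≡c = inj₂ (a≡c , a≡c⇒b<d a≡c)
... | no a≢c = inj₁ (FP.≤∧≢⇒< a≤c a≢c)

module Transition {n} (w : Permutation′ n) (p q : Fin n) (isP : IsP w p) (isQ : IsQ w p q)
                  (i : Fin n) (i∈I : i ∈I[ w ·t[ p , q ] , p ]) where
  p<q : p F.< q
  p<q = proj₁ (proj₁ isQ)

  wq<wp : (w ! q) F.< (w ! p)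
  wq<wp = proj₁ (proj₂ (proj₁ isQ))

  i₀ : Fin n
  i₀ = proj₁ (proj₂ (proj₂ (proj₁ isQ)))

  i₀<p : i₀ F.< p
  i₀<p = proj₁ (proj₂ (proj₂ (proj₂ (proj₁ isQ))))

  wi₀<wq : (w ! i₀) F.< (w ! q)
  wi₀<wq = proj₂ (proj₂ (proj₂ (proj₂ (proj₁ isQ))))

  i<p : i F.< p
  i<p = proj₁ i∈I

  i<q : i F.< q
  i<q = FP.<-trans i<p p<q

  >⇒≢ : ∀ {x y : Fin n} → x F.< y → y ≢ x
  >⇒≢ x<y y≡x = FP.<⇒≢ x<y (sym y≡x)

  w′ : Permutation′ n
  w′ = (w ·t[ p , q ]) ·t[ i , p ]

  w′-at-i : w′ ! i ≡ w ! q
  w′-at-i = trans (cong (λ k → w ! PC.transpose p q k) (transpose-left i p))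
                  (cong (w !_) (transpose-left p q))

  w′-at-p : w′ ! p ≡ w ! i
  w′-at-p = trans (cong (λ k → w ! PC.transpose p q k) (transpose-right i p))
                  (cong (w !_) (transpose-other p q (FP.<⇒≢ i<p) (FP.<⇒≢ i<q)))

  w′-at-q : w′ ! q ≡ w ! p
  w′-at-q = trans (cong (λ k → w ! PC.transpose p q k) (transpose-other i p (>⇒≢ i<q) (>⇒≢ p<q)))
                  (cong (w !_) (transpose-right p q))

  w′-elsewhere : ∀ {k} → k ≢ i → k ≢ p → k ≢ q → w′ ! k ≡ w ! k
  w′-elsewhere k≢i k≢p k≢q = trans (cong (λ k → w ! PC.transpose p q k) (transpose-other i p k≢i k≢p))
                                   (cong (w !_) (transpose-other p q k≢p k≢q))

  wi<wq : (w ! i) F.< (w ! q)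
  wi<wq = subst₂ F._<_ (cong (w !_) (transpose-other p q (FP.<⇒≢ i<p) (FP.<⇒≢ i<q)))
                       (cong (w !_) (transpose-left p q))
                       (∈I⇒ascent (w ·t[ p , q ]) i∈I)

  no-Mid132-beyond-p : ∀ {t} → p F.< t → ¬ Mid132 w t
  no-Mid132-beyond-p p<t mid = ℕP.<⇒≱ p<t (proj₂ isP _ mid)

  below-p-beyond-q : ∀ {b} → q F.< b → (w ! b) F.< (w ! p) → (w ! b) F.< (w ! q)
  below-p-beyond-q {b} q<b wb<wp with FP.<-cmp (w ! b) (w ! q)
  ... | tri< wb<wq _ _ = wb<wq
  ... | tri≈ _ wb≡wq _ = ⊥-elim (>⇒≢ q<b (!-injective w wb≡wq))
  ... | tri> _ _ wq<wb = ⊥-elim (ℕP.<⇒≱ q<b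
    (proj₂ isQ b (FP.<-trans p<q q<b , wb<wp , i₀ , i₀<p , FP.<-trans wi₀<wq wq<wb)))

  lowered-witness : ∀ {a t} → p F.< t → a F.< t → ∃[ a₀ ] ((a₀ F.< t) × ((w ! a₀) F.≤ (w′ ! a)))
  lowered-witness {a} {t} p<t a<t = by-cases a (a ≟ i) (a ≟ p) (a ≟ q) a<t
    where
    by-cases : ∀ a → Dec (a ≡ i) → Dec (a ≡ p) → Dec (a ≡ q) → a F.< t →
      ∃[ a₀ ] ((a₀ F.< t) × ((w ! a₀) F.≤ (w′ ! a)))
    by-cases _ (yes refl) _ _ _ =
      i₀ , FP.<-trans i₀<p p<t , subst ((w ! i₀) F.≤_) (sym w′-at-i) (ℕP.<⇒≤ wi₀<wq)
    by-cases _ (no _) (yes refl) _ _ =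
      i , FP.<-trans i<p p<t , ℕP.≤-reflexive (cong F.toℕ (sym w′-at-p))
    by-cases _ (no _) (no _) (yes refl) _ =
      p , p<t , ℕP.≤-reflexive (cong F.toℕ (sym w′-at-q))
    by-cases a (no a≢i) (no a≢p) (no a≢q) a<t =
      a , a<t , ℕP.≤-reflexive (cong F.toℕ (sym (w′-elsewhere a≢i a≢p a≢q)))

  w′-beyond-p : ∀ {k} → p F.< k → k ≢ q → w′ ! k ≡ w ! k
  w′-beyond-p p<k k≢q = w′-elsewhere (>⇒≢ (FP.<-trans i<p p<k)) (>⇒≢ p<k) k≢q

  descent-beyond-p : ∀ {t b} → p F.< t → t F.< b → b ≢ q → (w′ ! b) F.< (w′ ! t) → (w ! b) F.< (w ! t)
  descent-beyond-p {t} {b} p<t t<b b≢q w′b<w′t with t ≟ q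
  ... | yes refl =
    below-p-beyond-q t<b (subst₂ F._<_ (w′-beyond-p (FP.<-trans p<t t<b) b≢q) w′-at-q w′b<w′t)
  ... | no t≢q = subst₂ F._<_ (w′-beyond-p (FP.<-trans p<t t<b) b≢q) (w′-beyond-p p<t t≢q) w′b<w′t

  no-Mid132′-beyond-p : ∀ {t} → p F.< t → ¬ Mid132 w′ t
  no-Mid132′-beyond-p {t} p<t (a , b , a<t , t<b , w′a<w′b , w′b<w′t) with b ≟ q
  ... | yes refl = no-Mid132-beyond-p p<t (i₀ , q , FP.<-trans i₀<p p<t , t<b , wi₀<wq ,
          FP.<-trans wq<wp (subst₂ F._<_ w′-at-q (w′-beyond-p p<t (FP.<⇒≢ t<b)) w′b<w′t))
  ... | no b≢q with lowered-witness p<t a<t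
  ...   | a₀ , a₀<t , wa₀≤w′a = no-Mid132-beyond-p p<t (a₀ , b , a₀<t , t<b ,
          ℕP.≤-<-trans wa₀≤w′a (subst ((w′ ! a) F.<_) (w′-beyond-p (FP.<-trans p<t t<b) b≢q) w′a<w′b) ,
          descent-beyond-p p<t t<b b≢q w′b<w′t)

  Mid132′⇒≤p : ∀ {t} → Mid132 w′ t → t F.≤ p
  Mid132′⇒≤p mid = ℕP.≮⇒≥ (λ p<t → no-Mid132′-beyond-p p<t mid)

  QSet′-at-p-below-wq : ∀ {p′ j} → QSet w′ p′ j → p′ ≡ p → (w′ ! j) F.< (w ! q)
  QSet′-at-p-below-wq {j = j} (_ , w′j<w′p , _) refl =
    FP.<-trans (subst ((w′ ! j) F.<_) w′-at-p w′j<w′p) wi<wq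

-- The hypotheses Contains132 are implied by the existence of p and p′.
proposition4p8 : (n : ℕ) (w : Permutation′ n) → Contains132 w →
    (p q : Fin n) → IsP w p → IsQ w p q →
    (i : Fin n) → i ∈I[ w ·t[ p , q ] , p ] →
    Contains132 ((w ·t[ p , q ]) ·t[ i , p ]) →
    (p′ q′ : Fin n) → IsP ((w ·t[ p , q ]) ·t[ i , p ]) p′ →
    IsQ ((w ·t[ p , q ]) ·t[ i , p ]) p′ q′ →
    (p′ , ((w ·t[ p , q ]) ·t[ i , p ]) ! q′) <box (p , w ! q)
proposition4p8 n w _ p q isP isQ i i∈I _ p′ q′ isP′ isQ′ =
  <box-intro (Mid132′⇒≤p (proj₁ isP′)) (QSet′-at-p-below-wq (proj₁ isQ′))
  where open Transition w p q isP isQ i i∈I
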